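{- Consider a star instance with center agent $n$, a leaf agent $1$, and an agent $k\neq 1$ (possibly $k=n$). If $o_k\succ_k o_1$ or $o_n\succ_n o_1$, then $o_1$ is not reachable for agent $k$.
   Context: Agents $N=\{1,\dots,n\}$ form a star network with center $n$ and leaves $1,\dots,n-1$; objects $O=\{o_1,\dots,o_n\}$; each agent $i$ has a weak preference $\succeq_i$ (a complete preorder on $O$, ties allowed, strict part $\succ_i$); agent $i$ initially holds $o_i$. A swap exchanges the objects of two adjacent agents $i,j$ in an assignment $\sigma$ and is allowed only if $\sigma(j)\succeq_i\sigma(i)$ and $\sigma(i)\succeq_j\sigma(j)$. An object $o$ is reachable for agent $i$ if some sequence of allowed swaps from the initial assignment yields an assignment in which $i$ holds $o$. -}

module Defs where

open import Data.Nat using (ℕ; suc)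
open import Data.Fin using (Fin; zero; fromℕ)
import Data.Fin
import Data.Product
import Relation.Nullary
open import Data.Product using (_×_)
open import Data.Sum using (_⊎_)
open import Relation.Nullary using (¬_)
open import Relation.Binary.PropositionalEquality using (_≡_; _≢_)

-- Objects o_1..o_n are identified with their indices Fin n (object o_i ↔ i).
-- A preference profile: Pref i a b means a ⪰_i b (agent i weakly prefers a to b).
Profile : ℕ → Set₁
Profile n = Fin n → Fin n → Fin n → Set

record IsWeakProfile {n : ℕ} (P : Profile n) : Set where
  field
    total : ∀ i a b → P i a b ⊎ P i b a
    trans : ∀ i a b c → P i a b → P i b c → P i a c

Strict : {n : ℕ} → Profile n → Fin n → Fin n → Fin n → Set
Strict P i a b = P i a b × ¬ P i b a

-- Star network on agents Fin (suc m); the center is the last agent (agent n).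
center : (m : ℕ) → Fin (suc m)
center m = fromℕ m

Adjacent : (m : ℕ) → Fin (suc m) → Fin (suc m) → Set
Adjacent m i j = i ≢ j × (i ≡ center m ⊎ j ≡ center m)

Assignment : ℕ → Set
Assignment n = Fin n → Fin n

swapAt : {n : ℕ} → Fin n → Fin n → Assignment n → Assignment n
swapAt {n} i j σ x with x Data.Fin.≟ i
... | Relation.Nullary.yes _ = σ j
... | Relation.Nullary.no _ with x Data.Fin.≟ j
...   | Relation.Nullary.yes _ = σ i
...   | Relation.Nullary.no _ = σ x

data Step (m : ℕ) (P : Profile (suc m)) : Assignment (suc m) → Assignment (suc m) → Set where
  swap : ∀ σ i j → Adjacent m i j → P i (σ j) (σ i) → P j (σ i) (σ j)
       → Step m P σ (swapAt i j σ)

data Steps (m : ℕ) (P : Profile (suc m)) : Assignment (suc m) → Assignment (suc m) → Set where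
  done : ∀ σ → Steps m P σ σ
  step : ∀ σ τ ρ → Step m P σ τ → Steps m P τ ρ → Steps m P σ ρ

initial : {n : ℕ} → Assignment n
initial i = i

Reachable : (m : ℕ) → Profile (suc m) → Fin (suc m) → Fin (suc m) → Set
Reachable m P i o = Data.Product.Σ (Assignment (suc m)) λ σ → Steps m P initial σ × σ i ≡ o

{-# OPTIONS --safe #-}
-- Every allowed swap weakly improves both participants and leaves everybody
-- else unchanged, so each agent always holds an object she weakly prefers to
-- her endowment; hence if o_k ≻_k o_1, agent k can never hold o_1.
-- If o_n ≻_n o_1, the center always holds something ⪰_n o_n ≻_n o_1 and so
-- never accepts o_1; since in a star every swap involves the center, o_1 can
-- never leave leaf 1.
module Submission where

open import Defs
open import Data.Nat using (ℕ; suc; _≥_)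
open import Data.Fin using (Fin; zero; _≟_)
open import Data.Sum using (_⊎_; inj₁; inj₂) renaming (swap to ⊎-swap)
open import Data.Product using (_×_; _,_; proj₂)
open import Data.Empty using (⊥-elim)
open import Relation.Nullary using (¬_; yes; no)
open import Relation.Binary.PropositionalEquality
  using (_≢_; _≡_; refl; sym; trans; subst)

module _ {n : ℕ} {P : Profile n} (W : IsWeakProfile P) where
  open IsWeakProfile W using (total) renaming (trans to ⪰-trans)

  weak-refl : ∀ i a → P i a a
  weak-refl i a with total i a a
  ... | inj₁ p = p
  ... | inj₂ p = p

  ⪰-≻⇒⋡ : ∀ {i a b c} → Strict P i a b → P i c a → ¬ P i b c
  ⪰-≻⇒⋡ {i} {a} {b} {c} (_ , b⋠a) c⪰a b⪰c = b⋠a (⪰-trans i b c a b⪰c c⪰a)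

data SwapView {n : ℕ} (i j : Fin n) (σ : Assignment n) (x : Fin n) : Set where
  at-i  : x ≡ i → swapAt i j σ x ≡ σ j → SwapView i j σ x
  at-j  : x ≡ j → swapAt i j σ x ≡ σ i → SwapView i j σ x
  other : swapAt i j σ x ≡ σ x → SwapView i j σ x

swapView : {n : ℕ} (i j : Fin n) (σ : Assignment n) (x : Fin n) → SwapView i j σ x
swapView i j σ x with x ≟ i in x≟i
... | yes x≡i = at-i x≡i gets-σj
  where
  gets-σj : swapAt i j σ x ≡ σ j
  gets-σj rewrite x≟i = refl
... | no _ with x ≟ j in x≟j
...   | yes x≡j = at-j x≡j gets-σi
  where
  gets-σi : swapAt i j σ x ≡ σ i
  gets-σi rewrite x≟i | x≟j = refl
...   | no _ = other unchanged
  where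
  unchanged : swapAt i j σ x ≡ σ x
  unchanged rewrite x≟i | x≟j = refl

IndividuallyRational : {n : ℕ} → Profile n → Fin n → Assignment n → Set
IndividuallyRational P a σ = P a (σ a) a

module _ {m : ℕ} {P : Profile (suc m)} where

  Steps-preserves : (I : Assignment (suc m) → Set)
    → (∀ {σ τ} → Step m P σ τ → I σ → I τ)
    → ∀ {σ τ} → Steps m P σ τ → I σ → I τ
  Steps-preserves I step-pres (done _) h = h
  Steps-preserves I step-pres (step _ _ _ s ss) h = Steps-preserves I step-pres ss (step-pres s h)

  Step-improves : IsWeakProfile P → ∀ {σ τ} → Step m P σ τ → ∀ a → P a (τ a) (σ a)
  Step-improves W (swap σ i j _ i-accepts j-accepts) a with swapView i j σ a
  ... | at-i refl eq = subst (λ o → P a o (σ a)) (sym eq) i-accepts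
  ... | at-j refl eq = subst (λ o → P a o (σ a)) (sym eq) j-accepts
  ... | other eq     = subst (λ o → P a o (σ a)) (sym eq) (weak-refl W a (σ a))

  Steps-individuallyRational : IsWeakProfile P → ∀ a {σ τ} → Steps m P σ τ
    → IndividuallyRational P a σ → IndividuallyRational P a τ
  Steps-individuallyRational W a =
    Steps-preserves (IndividuallyRational P a)
      (λ {σ} {τ} s h → IsWeakProfile.trans W a (τ a) (σ a) a (Step-improves W s a) h)

  Reachable⇒weaklyPreferred : IsWeakProfile P → ∀ a o → Reachable m P a o → P a o a
  Reachable⇒weaklyPreferred W a o (σ , ss , σa≡o) =
    subst (λ o′ → P a o′ a) σa≡o
      (Steps-individuallyRational W a ss (weak-refl W a a))

zero≢center : (m : ℕ) → m ≥ 1 → zero ≢ center m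
zero≢center (suc m) _ ()

module _ {m : ℕ} (m≥1 : m ≥ 1) {P : Profile (suc m)} (W : IsWeakProfile P)
         (center-rejects : Strict P (center m) (center m) zero) where

  FirstObjectStaysHome : Assignment (suc m) → Set
  FirstObjectStaysHome σ = IndividuallyRational P (center m) σ × (∀ x → σ x ≡ zero → x ≡ zero)

  -- The giver of o_1 must be leaf 1, so the receiver is the center.
  first-not-accepted : ∀ σ r g → FirstObjectStaysHome σ
    → r ≡ center m ⊎ g ≡ center m → P r (σ g) (σ r) → σ g ≢ zero
  first-not-accepted σ r g (center-rational , stays) r-or-g-center r-accepts σg≡0
    with stays g σg≡0
  ... | refl with r-or-g-center
  ...   | inj₂ g≡center = zero≢center m m≥1 g≡center
  ...   | inj₁ refl =
    ⪰-≻⇒⋡ W center-rejects center-rational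
      (subst (λ o → P (center m) o (σ (center m))) σg≡0 r-accepts)

  Step-firstObjectStaysHome : ∀ {σ τ} → Step m P σ τ
    → FirstObjectStaysHome σ → FirstObjectStaysHome τ
  Step-firstObjectStaysHome s@(swap σ i j (_ , i-or-j-center) i-accepts j-accepts)
                            h@(center-rational , stays) =
    Steps-individuallyRational W (center m) (step _ _ _ s (done _)) center-rational , stays′
    where
    stays′ : ∀ x → swapAt i j σ x ≡ zero → x ≡ zero
    stays′ x τx≡0 with swapView i j σ x
    ... | at-i _ eq =
      ⊥-elim (first-not-accepted σ i j h i-or-j-center i-accepts (trans (sym eq) τx≡0))
    ... | at-j _ eq =
      ⊥-elim (first-not-accepted σ j i h (⊎-swap i-or-j-center) j-accepts (trans (sym eq) τx≡0))
    ... | other eq = stays x (trans (sym eq) τx≡0)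

lemma17 : (m : ℕ) → m ≥ 1 → (P : Profile (suc m)) → IsWeakProfile P
    → (k : Fin (suc m)) → k ≢ zero
    → Strict P k k zero ⊎ Strict P (center m) (center m) zero
    → ¬ Reachable m P k zero
lemma17 m m≥1 P W k k≢0 (inj₁ (_ , k-rejects)) reach =
  k-rejects (Reachable⇒weaklyPreferred W k zero reach)
lemma17 m m≥1 P W k k≢0 (inj₂ center-rejects) (σ , ss , σk≡0) =
  k≢0 (proj₂ (Steps-preserves (FirstObjectStaysHome m≥1 W center-rejects)
                (Step-firstObjectStaysHome m≥1 W center-rejects) ss
                (weak-refl W (center m) (center m) , λ x x≡0 → x≡0))
              k σk≡0)
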